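{- Let $G$ be a graph, let $D$ be a solvable distribution on $G$, and let $s=|\sigma(D)|$. Define $D_0=D$ and, for $i\ge0$, let $D_{i+1}$ be the distribution on $G\Box K_2^{i+1}$ (vertices written $(u,b)$ with $u\in V(G\Box K_2^{i})$ and $b\in\{0,1\}$ the new coordinate) given by $D_{i+1}((u,0))=E_{D_i(u)}(x_0)$ and $D_{i+1}((u,1))=E_{D_i(u)}(x_1)$. Then for every $m\ge0$, $D_m$ is a solvable distribution on $G\Box K_2^m\cong G\Box Q^m$ with $|\sigma(D_m)|\le 2^m s$ and \[|D_m|\le \left(\tfrac43\right)^m|D|+2^m s-\left(\tfrac43\right)^m s.\]
   Context: A distribution on a graph $G=(V,E)$ is a function $D:V\to\mathbb{N}$, with size $|D|=\sum_v D(v)$; its support is $\sigma(D)=\{v: D(v)>0\}$. A pebbling move removes two pebbles from a vertex having at least two pebbles and places one pebble on a neighbor. A distribution is solvable if for every vertex $v$, some sequence of pebbling moves starting from it results in a distribution with at least one pebble on $v$. $\Box$ is the Cartesian product of graphs, $K_2^m$ the $m$-fold product of $K_2$ (the hypercube $Q^m$). With $K_2$ having vertices $x_0,x_1$, for integers $k\ge0$ the distributions $E_r$ on $K_2$ are: $E_{3k}(x_0)=E_{3k}(x_1)=2k$; $E_{3k+1}(x_0)=2k+2$, $E_{3k+1}(x_1)=2k$; $E_{3k+2}(x_0)=2k+2$, $E_{3k+2}(x_1)=2k+1$. -}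

module Defs where

open import Data.Nat using (ℕ; zero; suc; _+_; _∸_; _≤_; _<?_)
open import Data.Fin using (Fin; remQuot; _≟_)
open import Data.Nat.ListAction using (sum)
open import Data.List using (List; map; length; filter; allFin)
open import Data.Bool using (if_then_else_)
open import Data.Product using (Σ; ∃; _×_; _,_)
open import Data.Sum using (_⊎_; inj₁; inj₂)
open import Relation.Nullary using (¬_; does)
open import Relation.Binary.PropositionalEquality using (_≡_; _≢_; refl; sym)
open import Relation.Binary.Construct.Closure.ReflexiveTransitive using (Star)

record Graph : Set₁ where
  field
    n      : ℕ
    Adj    : Fin n → Fin n → Set
    adjSym : ∀ {u v} → Adj u v → Adj v u
    irrefl : ∀ {u} → ¬ Adj u u
open Graph public

Dist : Graph → Set
Dist G = Fin (n G) → ℕ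

size : (G : Graph) → Dist G → ℕ
size G D = sum (map D (allFin (n G)))

supportSize : (G : Graph) → Dist G → ℕ
supportSize G D = length (filter (λ v → 0 <? D v) (allFin (n G)))

move : (G : Graph) → Dist G → Fin (n G) → Fin (n G) → Dist G
move G D u w x =
  (D x ∸ (if does (x ≟ u) then 2 else 0)) + (if does (x ≟ w) then 1 else 0)

data Step (G : Graph) (D : Dist G) : Dist G → Set where
  step : ∀ u w → Adj G u w → 2 ≤ D u → Step G D (move G D u w)

Solvable : (G : Graph) → Dist G → Set
Solvable G D = ∀ v → ∃ λ D' → Star (Step G) D D' × 1 ≤ D' v

-- G □ K₂; the vertex (u , b) with u : Fin n, b : Fin 2 is  combine u b : Fin (n * 2),
-- and remQuot 2 is its inverse.
private
  Adj□ : (G : Graph) → Fin (n G Data.Nat.* 2) → Fin (n G Data.Nat.* 2) → Set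
  Adj□ G k l with remQuot {n G} 2 k | remQuot {n G} 2 l
  ... | (u , b) | (w , c) = (Adj G u w × b ≡ c) ⊎ (u ≡ w × b ≢ c)

  sym□ : (G : Graph) → ∀ {k l} → Adj□ G k l → Adj□ G l k
  sym□ G {k} {l} a with remQuot {n G} 2 k | remQuot {n G} 2 l
  ... | (u , b) | (w , c) with a
  ... | inj₁ (p , q) = inj₁ (adjSym G p , sym q)
  ... | inj₂ (p , q) = inj₂ (sym p , λ e → q (sym e))

  irrefl□ : (G : Graph) → ∀ {k} → ¬ Adj□ G k k
  irrefl□ G {k} a with remQuot {n G} 2 k
  ... | (u , b) with a
  ... | inj₁ (p , _) = irrefl G p
  ... | inj₂ (_ , q) = q refl

_□K₂ : Graph → Graph
G □K₂ = record
  { n = n G Data.Nat.* 2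
  ; Adj = Adj□ G
  ; adjSym = sym□ G
  ; irrefl = irrefl□ G
  }

-- G □ K₂^m  (with (G □ K₂^(i+1)) = (G □ K₂^i) □ K₂, new coordinate last)
_□K₂^_ : Graph → ℕ → Graph
G □K₂^ zero = G
G □K₂^ suc m = (G □K₂^ m) □K₂

-- E_r on K₂, with x₀ = Fin index 0, x₁ = Fin index 1.
-- E_{3k} = (2k,2k), E_{3k+1} = (2k+2,2k), E_{3k+2} = (2k+2,2k+1).
E : ℕ → Fin 2 → ℕ
E 0 Fin.zero = 0
E 0 (Fin.suc Fin.zero) = 0
E 1 Fin.zero = 2
E 1 (Fin.suc Fin.zero) = 0
E 2 Fin.zero = 2
E 2 (Fin.suc Fin.zero) = 1
E (suc (suc (suc r))) b = 2 + E r b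

Dseq : (G : Graph) → Dist G → (m : ℕ) → Dist (G □K₂^ m)
Dseq G D zero = D
Dseq G D (suc i) k with remQuot {n (G □K₂^ i)} 2 k
... | (u , b) = E (Dseq G D i u) b

module Submission where

-- To reach a vertex of layer b of
-- G □ K₂, first pour pebbles along every rung from the opposite layer into layer b: E_r is
-- designed so that this leaves at least r pebbles on the layer-b end, so layer b now
-- dominates the old distribution and the moves reaching the target there can be copied.
-- For the size, each rung has 3 |E_r| ≤ 4 r + 2 [r > 0] and at most 2 [r > 0] occupied
-- ends; summing gives 3 |D_{i+1}| ≤ 4 |D_i| + 2 |σ(D_i)| and |σ(D_{i+1})| ≤ 2 |σ(D_i)|,
-- and the closed form follows by induction on m.

open import Defs
open import Data.Nat using (ℕ; zero; suc; _+_; _*_; _^_; _∸_; _≤_; z≤n; s≤s; _<?_)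
open import Data.Nat.Properties hiding (_≟_)
open import Data.Nat.ListAction using (sum)
open import Data.Nat.Tactic.RingSolver using (solve-∀)
open import Data.Fin as Fin using (Fin; combine; remQuot; opposite; _≟_)
open import Data.Fin.Patterns using (0F; 1F)
open import Data.Fin.Properties
  using (remQuot-combine; combine-remQuot; combine-injectiveˡ; combine-injectiveʳ)
open import Data.List using ([]; _∷_; length; filter; allFin)
import Data.List as List using (map; tabulate)
open import Data.List.Properties using (map-tabulate)
open import Data.List.Membership.Propositional using (_∈_)
open import Data.List.Membership.Propositional.Properties using (∈-allFin)
open import Data.List.Relation.Unary.Any using (here; there)
open import Data.Product using (_×_; _,_; ∃)
open import Data.Sum using (_⊎_; inj₁; inj₂)
open import Data.Bool using (if_then_else_)
open import Function using (id; _∘_)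
open import Function.Definitions using (Injective)
open import Relation.Nullary using (yes; no; does; contradiction)
open import Relation.Binary.PropositionalEquality
open import Relation.Binary.Construct.Closure.ReflexiveTransitive using (Star; ε; _◅_; _◅◅_)
open import Algebra.Properties.Semiring.Sum +-*-semiring
  using (sum-cong-≗; ∑-distrib-+; *-distribˡ-sum) renaming (sum to ∑)

sum-tabulate : ∀ {N} (f : Fin N → ℕ) → sum (List.tabulate f) ≡ ∑ f
sum-tabulate {zero}  f = refl
sum-tabulate {suc N} f = cong (f 0F +_) (sum-tabulate (f ∘ Fin.suc))

size≡∑ : (G : Graph) (D : Dist G) → size G D ≡ ∑ D
size≡∑ G D = trans (cong sum (map-tabulate id D)) (sum-tabulate D)

positive : ℕ → ℕ
positive zero    = 0
positive (suc _) = 1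

length-filter-positive : ∀ {A : Set} (f : A → ℕ) xs →
  length (filter (λ x → 0 <? f x) xs) ≡ sum (List.map (positive ∘ f) xs)
length-filter-positive f [] = refl
length-filter-positive f (x ∷ xs) with f x
... | zero  = length-filter-positive f xs
... | suc _ = cong suc (length-filter-positive f xs)

supportSize≡∑ : (G : Graph) (D : Dist G) → supportSize G D ≡ ∑ (positive ∘ D)
supportSize≡∑ G D = begin
  supportSize G D                              ≡⟨ length-filter-positive D (allFin (n G)) ⟩
  sum (List.map (positive ∘ D) (allFin (n G))) ≡⟨ cong sum (map-tabulate id (positive ∘ D)) ⟩
  sum (List.tabulate (positive ∘ D))           ≡⟨ sum-tabulate (positive ∘ D) ⟩
  ∑ (positive ∘ D)                             ∎
  where open ≡-Reasoning

∑-combine : ∀ {N} (f : Fin (N * 2) → ℕ) →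
  ∑ f ≡ ∑ {N} (λ u → f (combine u 0F) + f (combine u 1F))
∑-combine {zero}  f = refl
∑-combine {suc N} f = trans (sym (+-assoc (f 0F) (f 1F) _))
  (cong (f 0F + f 1F +_) (∑-combine {N} (f ∘ Fin.suc ∘ Fin.suc)))

∑-mono-≤ : ∀ {N} {f g : Fin N → ℕ} → (∀ i → f i ≤ g i) → ∑ f ≤ ∑ g
∑-mono-≤ {zero}  f≤g = z≤n
∑-mono-≤ {suc N} f≤g = +-mono-≤ (f≤g 0F) (∑-mono-≤ (f≤g ∘ Fin.suc))

E-size : ∀ r → 3 * (E r 0F + E r 1F) ≤ 4 * r + 2 * positive r
E-size zero    = z≤n
E-size (suc r) = E-size-suc r
  where
  E-size-suc : ∀ r → 3 * (E (suc r) 0F + E (suc r) 1F) ≤ 4 * suc r + 2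
  E-size-suc 0 = ≤-refl
  E-size-suc 1 = n≤1+n 9
  E-size-suc 2 = m≤m+n 12 2
  E-size-suc (suc (suc (suc r))) = begin
    3 * ((2 + x) + (2 + y))  ≡⟨ regroup x y ⟩
    12 + 3 * (x + y)         ≤⟨ +-monoʳ-≤ 12 (E-size-suc r) ⟩
    12 + (4 * suc r + 2)     ≡⟨ expand r ⟩
    4 * (4 + r) + 2          ∎
    where
    open ≤-Reasoning
    x y : ℕ
    x = E (suc r) 0F
    y = E (suc r) 1F
    regroup : ∀ x y → 3 * ((2 + x) + (2 + y)) ≡ 12 + 3 * (x + y)
    regroup = solve-∀
    expand : ∀ r → 12 + (4 * suc r + 2) ≡ 4 * (4 + r) + 2
    expand = solve-∀

positive≤1 : ∀ r → positive r ≤ 1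
positive≤1 zero    = z≤n
positive≤1 (suc _) = s≤s z≤n

E-support : ∀ r → positive (E r 0F) + positive (E r 1F) ≤ 2 * positive r
E-support zero    = z≤n
E-support (suc r) = +-mono-≤ (positive≤1 (E (suc r) 0F)) (positive≤1 (E (suc r) 1F))

E-pour : ∀ r b → ∃ λ k → 2 * k ≤ E r (opposite b) × r ≤ E r b + k
E-pour 0 0F = 0 , z≤n , z≤n
E-pour 0 1F = 0 , z≤n , z≤n
E-pour 1 0F = 0 , z≤n , s≤s z≤n
E-pour 1 1F = 1 , ≤-refl , ≤-refl
E-pour 2 0F = 0 , z≤n , ≤-refl
E-pour 2 1F = 1 , ≤-refl , ≤-refl
E-pour (suc (suc (suc r))) b with E-pour r b
... | k , 2k≤ , r≤ = suc k , 2[1+k]≤ , 3+r≤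
  where
  2[1+k]≤ : 2 * suc k ≤ 2 + E r (opposite b)
  2[1+k]≤ = subst (_≤ 2 + E r (opposite b)) (sym (*-suc 2 k)) (+-monoʳ-≤ 2 2k≤)
  3+r≤ : 3 + r ≤ (2 + E r b) + suc k
  3+r≤ = subst (3 + r ≤_) (sym (+-suc (2 + E r b) k)) (+-monoʳ-≤ 3 r≤)

-- Dseq G D (suc i) is definitionally liftE (G □K₂^ i) (Dseq G D i).
liftE : (H : Graph) → Dist H → Dist (H □K₂)
liftE H A k = let (u , b) = remQuot {n H} 2 k in E (A u) b

liftE-combine : (H : Graph) (A : Dist H) (u : Fin (n H)) (b : Fin 2) →
  liftE H A (combine u b) ≡ E (A u) b
liftE-combine H A u b = cong (λ (u , b) → E (A u) b) (remQuot-combine u b)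

∑-liftE : (H : Graph) (A : Dist H) (g : ℕ → ℕ) →
  ∑ (g ∘ liftE H A) ≡ ∑ (λ u → g (E (A u) 0F) + g (E (A u) 1F))
∑-liftE H A g = trans (∑-combine {n H} (g ∘ liftE H A))
  (sum-cong-≗ λ u → cong₂ _+_ (cong g (liftE-combine H A u 0F)) (cong g (liftE-combine H A u 1F)))

size-liftE : (H : Graph) (A : Dist H) →
  3 * size (H □K₂) (liftE H A) ≤ 4 * size H A + 2 * supportSize H A
size-liftE H A = begin
  3 * size (H □K₂) (liftE H A)
    ≡⟨ cong (3 *_) (trans (size≡∑ (H □K₂) (liftE H A)) (∑-liftE H A id)) ⟩
  3 * ∑ (λ u → E (A u) 0F + E (A u) 1F)
    ≡⟨ *-distribˡ-sum 3 (λ u → E (A u) 0F + E (A u) 1F) ⟩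
  ∑ (λ u → 3 * (E (A u) 0F + E (A u) 1F))
    ≤⟨ ∑-mono-≤ (E-size ∘ A) ⟩
  ∑ (λ u → 4 * A u + 2 * positive (A u))
    ≡⟨ ∑-distrib-+ (λ u → 4 * A u) (λ u → 2 * positive (A u)) ⟩
  ∑ (λ u → 4 * A u) + ∑ (λ u → 2 * positive (A u))
    ≡⟨ sym (cong₂ _+_ (*-distribˡ-sum 4 A) (*-distribˡ-sum 2 (positive ∘ A))) ⟩
  4 * ∑ A + 2 * ∑ (positive ∘ A)
    ≡⟨ sym (cong₂ (λ s σ → 4 * s + 2 * σ) (size≡∑ H A) (supportSize≡∑ H A)) ⟩
  4 * size H A + 2 * supportSize H A
    ∎
  where open ≤-Reasoning

supportSize-liftE : (H : Graph) (A : Dist H) →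
  supportSize (H □K₂) (liftE H A) ≤ 2 * supportSize H A
supportSize-liftE H A = begin
  supportSize (H □K₂) (liftE H A)
    ≡⟨ trans (supportSize≡∑ (H □K₂) (liftE H A)) (∑-liftE H A positive) ⟩
  ∑ (λ u → positive (E (A u) 0F) + positive (E (A u) 1F))
    ≤⟨ ∑-mono-≤ (E-support ∘ A) ⟩
  ∑ (λ u → 2 * positive (A u))
    ≡⟨ sym (*-distribˡ-sum 2 (positive ∘ A)) ⟩
  2 * ∑ (positive ∘ A)
    ≡⟨ cong (2 *_) (sym (supportSize≡∑ H A)) ⟩
  2 * supportSize H A
    ∎
  where open ≤-Reasoning

record Embedding (G H : Graph) : Set where
  field
    embed     : Fin (n G) → Fin (n H)
    injective : Injective _≡_ _≡_ embed
    adjacent  : ∀ {u w} → Adj G u w → Adj H (embed u) (embed w)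

module _ {G H : Graph} (φ : Embedding G H) where
  open Embedding φ

  Dominated : Dist G → Dist H → Set
  Dominated A C = ∀ u → A u ≤ C (embed u)

  does-≟-embed : ∀ x y → does (x ≟ y) ≡ does (embed x ≟ embed y)
  does-≟-embed x y with x ≟ y | embed x ≟ embed y
  ... | yes _   | yes _   = refl
  ... | no _    | no _    = refl
  ... | yes x≡y | no fx≢fy = contradiction (cong embed x≡y) fx≢fy
  ... | no x≢y  | yes fx≡fy = contradiction (injective fx≡fy) x≢y

  move-embed : ∀ {A C} → Dominated A C →
    ∀ u w → Dominated (move G A u w) (move H C (embed u) (embed w))
  move-embed A≤C u w x rewrite does-≟-embed x u | does-≟-embed x w =
    +-monoˡ-≤ _ (∸-monoˡ-≤ (if does (embed x ≟ embed u) then 2 else 0) (A≤C x))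

  Star-embed : ∀ {A A' C} → Star (Step G) A A' → Dominated A C →
    ∃ λ C' → Star (Step H) C C' × Dominated A' C'
  Star-embed ε A≤C = _ , ε , A≤C
  Star-embed {C = C} (step u w uw 2≤Au ◅ steps) A≤C
    with Star-embed steps (move-embed {C = C} A≤C u w)
  ... | C' , steps' , A'≤C' =
    C' , step (embed u) (embed w) (adjacent uw) (≤-trans 2≤Au (A≤C u)) ◅ steps' , A'≤C'

module _ (H : Graph) (C : Dist H) (s t : Fin (n H)) where
  move-other : ∀ x → x ≢ s → C x ≤ move H C s t x
  move-other x x≢s with x ≟ s
  ... | yes x≡s = contradiction x≡s x≢s
  ... | no _    = m≤m+n (C x) _

  move-source : C s ∸ 2 ≤ move H C s t s
  move-source with s ≟ s
  ... | yes _   = m≤m+n (C s ∸ 2) _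
  ... | no s≢s  = contradiction refl s≢s

  move-target : t ≢ s → C t + 1 ≤ move H C s t t
  move-target t≢s with t ≟ s | t ≟ t
  ... | yes t≡s | _       = contradiction t≡s t≢s
  ... | no _    | yes _   = ≤-refl
  ... | no _    | no t≢t  = contradiction refl t≢t

pour : (H : Graph) {s t : Fin (n H)} → Adj H s t → ∀ k (C : Dist H) → 2 * k ≤ C s →
  ∃ λ C' → Star (Step H) C C' × C t + k ≤ C' t × (∀ x → x ≢ s → C x ≤ C' x)
pour H {t = t} st zero C _ = C , ε , ≤-reflexive (+-identityʳ (C t)) , λ _ _ → ≤-refl
pour H {s} {t} st (suc k) C 2[1+k]≤Cs =
  let C' , steps , C₁t+k≤C't , C₁≤C' = pour H st k C₁ 2k≤C₁s
  in C' , step s t st 2≤Cs ◅ steps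
        , ≤-trans (≤-reflexive (sym (+-assoc (C t) 1 k)))
                  (≤-trans (+-monoˡ-≤ k Ct+1≤C₁t) C₁t+k≤C't)
        , λ x x≢s → ≤-trans (move-other H C s t x x≢s) (C₁≤C' x x≢s)
  where
  C₁ : Dist H
  C₁ = move H C s t
  2+2k≤Cs : 2 + 2 * k ≤ C s
  2+2k≤Cs = subst (_≤ C s) (*-suc 2 k) 2[1+k]≤Cs
  2≤Cs : 2 ≤ C s
  2≤Cs = ≤-trans (m≤m+n 2 (2 * k)) 2+2k≤Cs
  2k≤C₁s : 2 * k ≤ C₁ s
  2k≤C₁s = ≤-trans (∸-monoˡ-≤ 2 2+2k≤Cs) (move-source H C s t)
  Ct+1≤C₁t : C t + 1 ≤ C₁ t
  Ct+1≤C₁t = move-target H C s t (λ t≡s → irrefl H (subst (Adj H s) t≡s st))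

Adj-□K₂-combine : (H : Graph) (u w : Fin (n H)) (b c : Fin 2) →
  Adj (H □K₂) (combine u b) (combine w c) ≡ ((Adj H u w × b ≡ c) ⊎ (u ≡ w × b ≢ c))
Adj-□K₂-combine H u w b c =
  cong₂ (λ (u , b) (w , c) → (Adj H u w × b ≡ c) ⊎ (u ≡ w × b ≢ c))
    (remQuot-combine u b) (remQuot-combine w c)

layer : (H : Graph) (b : Fin 2) → Embedding H (H □K₂)
layer H b = record
  { embed     = λ u → combine u b
  ; injective = λ {u} {w} eq → combine-injectiveˡ u b w b eq
  ; adjacent  = λ uw → subst id (sym (Adj-□K₂-combine H _ _ b b)) (inj₁ (uw , refl))
  }

rung : (H : Graph) (u : Fin (n H)) {b c : Fin 2} → b ≢ c → Adj (H □K₂) (combine u b) (combine u c)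
rung H u b≢c = subst id (sym (Adj-□K₂-combine H u u _ _)) (inj₂ (refl , b≢c))

opposite-≢ : (b : Fin 2) → opposite b ≢ b
opposite-≢ 0F ()
opposite-≢ 1F ()

module LayerFilling (H : Graph) (D : Dist H) (b : Fin 2) where
  private
    b̄ : Fin 2
    b̄ = opposite b

  Refillable : Dist (H □K₂) → Fin (n H) → Set
  Refillable C u = ∃ λ k → 2 * k ≤ C (combine u b̄) × D u ≤ C (combine u b) + k

  combine-b≢b̄ : ∀ u v → combine {n H} u b ≢ combine v b̄
  combine-b≢b̄ u v eq = opposite-≢ b (sym (combine-injectiveʳ u b v b̄ eq))

  liftE-refillable : ∀ u → Refillable (liftE H D) u
  liftE-refillable u =
    let k , 2k≤ , Du≤ = E-pour (D u) b
    in k , subst (2 * k ≤_) (sym (liftE-combine H D u b̄)) 2k≤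
         , subst (λ x → D u ≤ x + k) (sym (liftE-combine H D u b)) Du≤

  refill-rung : ∀ {C u} → Refillable C u →
    ∃ λ C' → Star (Step (H □K₂)) C C' × D u ≤ C' (combine u b)
                                      × (∀ x → x ≢ combine u b̄ → C x ≤ C' x)
  refill-rung {C} {u} (k , 2k≤ , Du≤) =
    let C' , steps , gained , C≤C' = pour (H □K₂) (rung H u (opposite-≢ b)) k C 2k≤
    in C' , steps , ≤-trans Du≤ gained , C≤C'

  refillable-preserved : ∀ {C C' u} → D u ≤ C' (combine u b) →
    (∀ x → x ≢ combine u b̄ → C x ≤ C' x) →
    (∀ v → Refillable C v) → ∀ v → Refillable C' v
  refillable-preserved {u = u} Du≤ C≤C' refillable v with v ≟ u
  ... | yes refl = 0 , z≤n , ≤-trans Du≤ (m≤m+n _ 0)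
  ... | no v≢u =
    let k , 2k≤ , Dv≤ = refillable v
    in k , ≤-trans 2k≤ (C≤C' _ (v≢u ∘ combine-injectiveˡ v b̄ u b̄))
         , ≤-trans Dv≤ (+-monoˡ-≤ k (C≤C' _ (combine-b≢b̄ v u)))

  fill : ∀ xs C → (∀ v → Refillable C v) →
    ∃ λ C' → Star (Step (H □K₂)) C C' × (∀ u → u ∈ xs → D u ≤ C' (combine u b))
                                      × (∀ u → C (combine u b) ≤ C' (combine u b))
  fill [] C _ = C , ε , (λ _ ()) , λ _ → ≤-refl
  fill (u ∷ xs) C refillable with refill-rung (refillable u)
  ... | C₁ , steps₁ , Du≤C₁ , C≤C₁
    with fill xs C₁ (refillable-preserved Du≤C₁ C≤C₁ refillable)
  ... | C₂ , steps₂ , filled , C₁≤C₂ =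
    C₂ , steps₁ ◅◅ steps₂ , filled′ , λ v → ≤-trans (C≤C₁ _ (combine-b≢b̄ v u)) (C₁≤C₂ v)
    where
    filled′ : ∀ v → v ∈ u ∷ xs → D v ≤ C₂ (combine v b)
    filled′ v (here refl) = ≤-trans Du≤C₁ (C₁≤C₂ v)
    filled′ v (there v∈xs) = filled v v∈xs

  fill-layer : ∃ λ C → Star (Step (H □K₂)) (liftE H D) C × Dominated (layer H b) D C
  fill-layer =
    let C , steps , filled , _ = fill (allFin (n H)) (liftE H D) liftE-refillable
    in C , steps , λ u → filled u (∈-allFin u)

solvable-liftE : (H : Graph) (A : Dist H) → Solvable H A → Solvable (H □K₂) (liftE H A)
solvable-liftE H A solvable k =
  subst (λ k → ∃ λ C → Star (Step (H □K₂)) (liftE H A) C × 1 ≤ C k) (combine-remQuot {n H} 2 k)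
    (reach (remQuot {n H} 2 k))
  where
  reach : ∀ ((v , b) : Fin (n H) × Fin 2) →
    ∃ λ C → Star (Step (H □K₂)) (liftE H A) C × 1 ≤ C (combine v b)
  reach (v , b) =
    let A' , solve-v , 1≤A'v = solvable v
        C₁ , fill-steps , A≤C₁ = LayerFilling.fill-layer H A b
        C₂ , copied-steps , A'≤C₂ = Star-embed (layer H b) solve-v A≤C₁
    in C₂ , fill-steps ◅◅ copied-steps , ≤-trans 1≤A'v (A'≤C₂ v)

*-^-distrib : ∀ a b m → (a * b) ^ m ≡ a ^ m * b ^ m
*-^-distrib a b zero    = refl
*-^-distrib a b (suc m) = trans (cong (a * b *_) (*-^-distrib a b m))
  ([m*n]*[o*p]≡[m*o]*[n*p] a b (a ^ m) (b ^ m))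

size-bound-step : ∀ m {x y σ s S} → 3 * y ≤ 4 * x + 2 * σ → σ ≤ 2 ^ m * s →
  3 ^ m * x + 4 ^ m * s ≤ 4 ^ m * S + 6 ^ m * s →
  3 ^ suc m * y + 4 ^ suc m * s ≤ 4 ^ suc m * S + 6 ^ suc m * s
size-bound-step m {x} {y} {σ} {s} {S} 3y≤ σ≤ bound = begin
  3 ^ suc m * y + 4 ^ suc m * s               ≡⟨ regroup (3 ^ m) (4 ^ m) y s ⟩
  3 ^ m * (3 * y) + 4 * (4 ^ m * s)           ≤⟨ +-monoˡ-≤ _ (*-monoʳ-≤ (3 ^ m) 3y≤′) ⟩
  3 ^ m * (4 * x + 2 * (2 ^ m * s)) + 4 * (4 ^ m * s)
    ≡⟨ expand (3 ^ m) (4 ^ m) (2 ^ m) x s ⟩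
  4 * (3 ^ m * x + 4 ^ m * s) + 2 * (3 ^ m * 2 ^ m * s)
    ≡⟨ cong (λ p → 4 * (3 ^ m * x + 4 ^ m * s) + 2 * (p * s)) (sym (*-^-distrib 3 2 m)) ⟩
  4 * (3 ^ m * x + 4 ^ m * s) + 2 * (6 ^ m * s) ≤⟨ +-monoˡ-≤ _ (*-monoʳ-≤ 4 bound) ⟩
  4 * (4 ^ m * S + 6 ^ m * s) + 2 * (6 ^ m * s) ≡⟨ collect (4 ^ m) (6 ^ m) S s ⟩
  4 ^ suc m * S + 6 ^ suc m * s               ∎
  where
  open ≤-Reasoning
  3y≤′ : 3 * y ≤ 4 * x + 2 * (2 ^ m * s)
  3y≤′ = ≤-trans 3y≤ (+-monoʳ-≤ (4 * x) (*-monoʳ-≤ 2 σ≤))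
  regroup : ∀ p q y s → 3 * p * y + 4 * q * s ≡ p * (3 * y) + 4 * (q * s)
  regroup = solve-∀
  expand : ∀ p q r x s →
    p * (4 * x + 2 * (r * s)) + 4 * (q * s) ≡ 4 * (p * x + q * s) + 2 * (p * r * s)
  expand = solve-∀
  collect : ∀ q t S s → 4 * (q * S + t * s) + 2 * (t * s) ≡ 4 * q * S + 6 * t * s
  collect = solve-∀

theorem6p5 : (G : Graph) (D : Dist G) → Solvable G D → (m : ℕ) →
    Solvable (G □K₂^ m) (Dseq G D m)
    × supportSize (G □K₂^ m) (Dseq G D m) ≤ 2 ^ m * supportSize G D
    × 3 ^ m * size (G □K₂^ m) (Dseq G D m) + 4 ^ m * supportSize G D
        ≤ 4 ^ m * size G D + 6 ^ m * supportSize G D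
theorem6p5 G D solvable zero = solvable , ≤-reflexive (sym (*-identityˡ _)) , ≤-refl
theorem6p5 G D solvable (suc m) =
  let solvableₘ , supportₘ , sizeₘ = theorem6p5 G D solvable m
      Gₘ = G □K₂^ m
      Dₘ = Dseq G D m
  in solvable-liftE Gₘ Dₘ solvableₘ
   , ≤-trans (supportSize-liftE Gₘ Dₘ)
       (≤-trans (*-monoʳ-≤ 2 supportₘ) (≤-reflexive (sym (*-assoc 2 (2 ^ m) (supportSize G D)))))
   , size-bound-step m (size-liftE Gₘ Dₘ) supportₘ sizeₘ
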